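{- For positive integers $r,c$, let $(c^r)$ denote the rectangular partition with $r$ rows each of length $c$. Then the number of nodes in the game tree of Downright played on $(c^r)$ equals $\binom{r+c}{r}-1$.
   Context: A partition $\lambda=(\lambda_1,\dots,\lambda_r)$ with $\lambda_1\ge\dots\ge\lambda_r>0$ is identified with its Young diagram. For integers $i,j\ge 0$, $\lambda[i,j]$ denotes the subpartition obtained by deleting the top $i$ rows and the leftmost $j$ columns. In the impartial game Downright played on $\lambda$ (a rook in the top-left box moving one box down or right within the diagram), the move to $\lambda[1,0]$ is allowed when $r>1$ and the move to $\lambda[0,1]$ is allowed when $\lambda_1>1$; the partition $(1)$ is terminal. The game tree of a position $p$ is the rooted tree with root $p$ and, for each move $p\to\tilde p$, an edge from $p$ to the root of the game tree of $\tilde p$ (so repeated positions appear as distinct nodes). -}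

module Defs where

open import Data.Nat using (ℕ; zero; suc; _+_; _∸_; _<_; _≤_)
open import Data.List using (List; []; _∷_; _++_; length; replicate; drop; map; filter)
open import Data.Nat.Properties using (_<?_)
import Relation.Nullary

-- A partition (λ₁ ≥ … ≥ λᵣ > 0) is represented as the list of its row lengths.
Partition : Set
Partition = List ℕ

sub : Partition → ℕ → ℕ → Partition
sub λ′ i j = filter (0 <?_) (map (_∸ j) (drop i λ′))

rows : Partition → ℕ
rows = length

firstRow : Partition → ℕ
firstRow []      = 0
firstRow (x ∷ _) = x

downMove : Partition → List Partition
downMove λ′ with 1 <? rows λ′
... | Relation.Nullary.yes _ = sub λ′ 1 0 ∷ []
... | Relation.Nullary.no  _ = []

rightMove : Partition → List Partition
rightMove λ′ with 1 <? firstRow λ′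
... | Relation.Nullary.yes _ = sub λ′ 0 1 ∷ []
... | Relation.Nullary.no  _ = []

moves : Partition → List Partition
moves λ′ = downMove λ′ ++ rightMove λ′

data Tree : Set where
  node : List Tree → Tree

mutual
  nodes : Tree → ℕ
  nodes (node ts) = suc (nodesList ts)

  nodesList : List Tree → ℕ
  nodesList []       = 0
  nodesList (t ∷ ts) = nodes t + nodesList ts

mutual
  data IsGameTree : Partition → Tree → Set where
    gt : ∀ {p ts} → AllGameTrees (moves p) ts → IsGameTree p (node ts)

  data AllGameTrees : List Partition → List Tree → Set where
    []  : AllGameTrees [] []
    _∷_ : ∀ {p ps t ts} → IsGameTree p t → AllGameTrees ps ts →
          AllGameTrees (p ∷ ps) (t ∷ ts)

rect : ℕ → ℕ → Partition
rect r c = replicate r c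

-- Moving down or right in a rectangle (c^r) leads to the rectangle with one side
-- shortened by 1.  Hence N(r,c) + 1, where N counts the nodes of the game tree,
-- obeys Pascal's rule  B(r,c) = B(r-1,c) + B(r,c-1),  with value 1 in place of a
-- side that would vanish (the missing move), so it equals binom(r+c, r).
module Submission where

open import Defs
open import Data.Nat using (ℕ; zero; suc; _+_; _∸_; _<_; _≤_; s≤s; z≤n)
open import Data.Nat.Combinatorics using (_C_; nCn≡1; nCk+nC[k+1]≡[n+1]C[k+1])
open import Data.Nat.Properties using (_<?_; +-suc; +-identityʳ; +-comm; m<n⇒0<n∸m)
open import Data.List using ([]; _∷_; drop; map; filter; replicate)
open import Data.List.Properties using (map-replicate; filter-all)
open import Data.List.Relation.Unary.All.Properties using (replicate⁺)
open import Data.Product using (Σ; _×_; _,_)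
open import Function using (_∘_)
open import Relation.Binary.PropositionalEquality
open ≡-Reasoning

drop-replicate : ∀ {A : Set} i r (x : A) → drop i (replicate r x) ≡ replicate (r ∸ i) x
drop-replicate zero    r       x = refl
drop-replicate (suc i) zero    x = refl
drop-replicate (suc i) (suc r) x = drop-replicate i r x

sub-rect : ∀ r c i j → j < c → sub (rect r c) i j ≡ rect (r ∸ i) (c ∸ j)
sub-rect r c i j j<c = begin
  filter (0 <?_) (map (_∸ j) (drop i (replicate r c)))
    ≡⟨ cong (filter (0 <?_) ∘ map (_∸ j)) (drop-replicate i r c) ⟩
  filter (0 <?_) (map (_∸ j) (replicate (r ∸ i) c))
    ≡⟨ cong (filter (0 <?_)) (map-replicate (_∸ j) (r ∸ i) c) ⟩
  filter (0 <?_) (replicate (r ∸ i) (c ∸ j))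
    ≡⟨ filter-all (0 <?_) (replicate⁺ (r ∸ i) (m<n⇒0<n∸m j<c)) ⟩
  replicate (r ∸ i) (c ∸ j) ∎

sub-rect-down : ∀ r c → sub (rect (suc r) (suc c)) 1 0 ≡ rect r (suc c)
sub-rect-down r c = sub-rect (suc r) (suc c) 1 0 (s≤s z≤n)

sub-rect-right : ∀ r c → sub (rect r (suc (suc c))) 0 1 ≡ rect r (suc c)
sub-rect-right r c = sub-rect r (suc (suc c)) 0 1 (s≤s (s≤s z≤n))

IsGameTree-resp : ∀ {p q t} → p ≡ q → IsGameTree p t → IsGameTree q t
IsGameTree-resp {t = t} = subst (λ p → IsGameTree p t)

rect-gameTree : ∀ a b → Σ Tree (IsGameTree (rect (suc a) (suc b)))
rect-gameTree zero    zero    = node [] , gt []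
rect-gameTree (suc a) zero    with t , g ← rect-gameTree a zero =
  node (t ∷ []) , gt (IsGameTree-resp (sym (sub-rect-down (suc a) 0)) g ∷ [])
rect-gameTree zero    (suc b) with t , g ← rect-gameTree zero b =
  node (t ∷ []) , gt (IsGameTree-resp (sym (sub-rect-right 1 b)) g ∷ [])
rect-gameTree (suc a) (suc b)
  with t₁ , g₁ ← rect-gameTree a (suc b) | t₂ , g₂ ← rect-gameTree (suc a) b =
  node (t₁ ∷ t₂ ∷ []) ,
  gt (IsGameTree-resp (sym (sub-rect-down (suc a) (suc b))) g₁ ∷
      IsGameTree-resp (sym (sub-rect-right (suc (suc a)) b)) g₂ ∷ [])

binom-pascal : ∀ r c → (suc r + suc c) C suc r ≡ (r + suc c) C r + (suc r + c) C suc r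
binom-pascal r c = begin
  suc (r + suc c) C suc r                     ≡⟨ nCk+nC[k+1]≡[n+1]C[k+1] (r + suc c) r ⟨
  (r + suc c) C r + (r + suc c) C suc r       ≡⟨ cong (λ n → (r + suc c) C r + n C suc r) (+-suc r c) ⟩
  (r + suc c) C r + (suc r + c) C suc r       ∎

binom-zeroʳ : ∀ r → (r + 0) C r ≡ 1
binom-zeroʳ r = trans (cong (_C r) (+-identityʳ r)) (nCn≡1 r)

suc-nodes-node₁ : ∀ t → suc (nodes (node (t ∷ []))) ≡ suc (nodes t) + 1
suc-nodes-node₁ t = cong suc (trans (cong suc (+-identityʳ (nodes t))) (+-comm 1 (nodes t)))

suc-nodes-node₂ : ∀ t₁ t₂ → suc (nodes (node (t₁ ∷ t₂ ∷ []))) ≡ suc (nodes t₁) + suc (nodes t₂)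
suc-nodes-node₂ t₁ t₂ =
  cong suc (trans (cong (λ n → suc (nodes t₁ + n)) (+-identityʳ (nodes t₂))) (sym (+-suc (nodes t₁) (nodes t₂))))

-- For concrete shapes `moves (rect (suc a) (suc b))` computes, so the patterns on
-- the children below are exhaustive.
suc-nodes-rect : ∀ a b {t} → IsGameTree (rect (suc a) (suc b)) t → suc (nodes t) ≡ (suc a + suc b) C suc a
suc-nodes-rect zero zero (gt []) = refl
suc-nodes-rect (suc a) zero {node (t ∷ [])} (gt (g ∷ [])) = begin
  suc (nodes (node (t ∷ [])))                           ≡⟨ suc-nodes-node₁ t ⟩
  suc (nodes t) + 1                                     ≡⟨ cong₂ _+_ below (sym (binom-zeroʳ (suc (suc a)))) ⟩
  (suc a + 1) C suc a + (suc (suc a) + 0) C suc (suc a) ≡⟨ binom-pascal (suc a) 0 ⟨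
  (suc (suc a) + 1) C suc (suc a)                       ∎
  where
  below : suc (nodes t) ≡ (suc a + 1) C suc a
  below = suc-nodes-rect a zero (IsGameTree-resp (sub-rect-down (suc a) 0) g)
suc-nodes-rect zero (suc b) {node (t ∷ [])} (gt (g ∷ [])) = begin
  suc (nodes (node (t ∷ [])))                           ≡⟨ suc-nodes-node₁ t ⟩
  suc (nodes t) + 1                                     ≡⟨ +-comm (suc (nodes t)) 1 ⟩
  1 + suc (nodes t)                                     ≡⟨ cong suc right ⟩
  1 + (1 + suc b) C 1                                   ≡⟨ binom-pascal 0 (suc b) ⟨
  (1 + suc (suc b)) C 1                                 ∎
  where
  right : suc (nodes t) ≡ (1 + suc b) C 1
  right = suc-nodes-rect zero b (IsGameTree-resp (sub-rect-right 1 b) g)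
suc-nodes-rect (suc a) (suc b) {node (t₁ ∷ t₂ ∷ [])} (gt (g₁ ∷ g₂ ∷ [])) = begin
  suc (nodes (node (t₁ ∷ t₂ ∷ [])))                     ≡⟨ suc-nodes-node₂ t₁ t₂ ⟩
  suc (nodes t₁) + suc (nodes t₂)                       ≡⟨ cong₂ _+_ below right ⟩
  (suc a + suc (suc b)) C suc a + (suc (suc a) + suc b) C suc (suc a) ≡⟨ binom-pascal (suc a) (suc b) ⟨
  (suc (suc a) + suc (suc b)) C suc (suc a)             ∎
  where
  below : suc (nodes t₁) ≡ (suc a + suc (suc b)) C suc a
  below = suc-nodes-rect a (suc b) (IsGameTree-resp (sub-rect-down (suc a) (suc b)) g₁)
  right : suc (nodes t₂) ≡ (suc (suc a) + suc b) C suc (suc a)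
  right = suc-nodes-rect (suc a) b (IsGameTree-resp (sub-rect-right (suc (suc a)) b) g₂)

lemma6p6 : (r c : ℕ) → 1 ≤ r → 1 ≤ c →
    Σ Tree (IsGameTree (rect r c))
    × ((t : Tree) → IsGameTree (rect r c) t → nodes t ≡ ((r + c) C r) ∸ 1)
lemma6p6 (suc a) (suc b) _ _ =
  rect-gameTree a b , λ t g → cong (_∸ 1) (suc-nodes-rect a b g)
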